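{- Let $d \ge 2$ and let $T$ be a tree with $s=\operatorname{diam}(T) \geq 2d+1$. Let $P=v_1v_2 \dots v_{s+1}$ be a diametrical path in $T$ and root $T$ at $v_{s+1}$. Suppose that $T$ has no $P_{d+1}$-support vertex and no $(P_i,P_j)$-support vertex with $i \in \{1,\dots,d-1\}$ and $j \in \{1,\dots,d\}$. Then: (i) if $k \in \{2, \dots, d\} \cup \{s-d+2, \dots ,s\}$, then $\deg(v_k) = 2$; (ii) if $k \in \{ d+1, s - d + 1 \}$, then $\deg(v_{k}) \geq 3$; (iii) for every $v \in V(T)$, if $v$ is the only vertex of $T_v$ having degree at least $3$ in $T$ (in particular $\deg_T(v)\ge 3$), then $T_v$ is isomorphic to the $(d-1)$-subdivision of a star $K_{1,t}$ with $t \geq 2$; (iv) the subtree $T_{v_{d+1}}$ is isomorphic to the $(d-1)$-subdivision of a star $K_{1,t}$ with $t \geq 2$; (v) if $s=2d+1$, then $T$ is obtained by taking the $(d-1)$-subdivisions of two stars $K_{1,t_1}$ with $t_1 \geq 2$ and $K_{1,t_2}$ with $t_2 \geq 2$ and adding an edge between their centers.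
   Context: $P_k$ denotes the path on $k$ vertices. In a tree $T$, a copy of $P_k$ is attached to a vertex $v$ (a pendant $P_k$ at $v$) if $T-v$ has a component which is a path $x_1x_2\dots x_k$ on $k$ vertices with $v$ adjacent in $T$ only to its end vertex $x_k$ (so $x_1$ is a leaf of $T$). A vertex $v$ is a $P_k$-support vertex if a copy of $P_k$ is attached to it, and a $(P_i,P_j)$-support vertex if both a copy of $P_i$ and a (different) copy of $P_j$ are attached to it (for $i=j$, at least two copies of $P_i$). In a rooted tree, $T_v$ denotes the subtree induced by $v$ and its descendants. The $(d-1)$-subdivision of a graph is obtained by subdividing each edge $d-1$ times (replacing it by a path with $d-1$ internal vertices). -}

module Defs where

open import Data.Nat using (ℕ; zero; suc; _+_; _*_; _∸_; _≤_; _<_; pred)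
open import Data.Fin using (Fin; toℕ)
open import Data.Bool using (Bool; true; false; if_then_else_)
open import Data.List using (List; []; _∷_; length; head; last; allFin; map)
open import Data.Nat.ListAction using (sum)
open import Data.List.Relation.Unary.Linked using (Linked)
open import Data.List.Relation.Unary.Unique.Propositional using (Unique)
open import Data.List.Membership.Propositional using (_∈_)
open import Data.Maybe using (Maybe; just; nothing)
open import Data.Product using (Σ; ∃; _×_; _,_)
open import Data.Sum using (_⊎_)
open import Data.Empty using (⊥)
open import Relation.Nullary using (¬_)
open import Relation.Binary.PropositionalEquality using (_≡_; _≢_)
open import Function.Bundles using (_⇔_)

record FinGraph (n : ℕ) : Set where
  field
    adj   : Fin n → Fin n → Bool
    sym   : ∀ u v → adj u v ≡ adj v u
    irrefl : ∀ v → adj v v ≡ false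

module _ {n : ℕ} (G : FinGraph n) where
  open FinGraph G

  E : Fin n → Fin n → Set
  E u v = adj u v ≡ true

  deg : Fin n → ℕ
  deg v = sum (map (λ u → if adj v u then 1 else 0) (allFin n))

  IsPath : Fin n → Fin n → List (Fin n) → Set
  IsPath u w p = Linked E p × Unique p × head p ≡ just u × last p ≡ just w

  IsCycle : List (Fin n) → Set
  IsCycle p = 3 ≤ length p × Linked E p × Unique p
            × Σ (Fin n) λ a → Σ (Fin n) λ b → head p ≡ just a × last p ≡ just b × E b a

  Connected : Set
  Connected = ∀ u w → ∃ λ p → IsPath u w p

  Acyclic : Set
  Acyclic = ∀ p → ¬ IsCycle p

  IsTree : Set
  IsTree = Connected × Acyclic

  Dist : Fin n → Fin n → ℕ → Set
  Dist u w k = (∃ λ p → IsPath u w p × length p ≡ suc k)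
             × (∀ p → IsPath u w p → suc k ≤ length p)

  Diam : ℕ → Set
  Diam s = (Σ (Fin n) λ u → Σ (Fin n) λ w → Dist u w s)
         × (∀ u w k → Dist u w k → k ≤ s)

  -- v₁ v₂ … v_{s+1} (given as v : ℕ → Fin n, only indices 1..s+1 matter)
  -- is a path with s edges, where s = diam(G): a diametrical path
  DiamPath : ℕ → (ℕ → Fin n) → Set
  DiamPath s v = Diam s
               × (∀ i → 1 ≤ i → i ≤ s → E (v i) (v (suc i)))
               × (∀ i j → 1 ≤ i → i ≤ suc s → 1 ≤ j → j ≤ suc s → v i ≡ v j → i ≡ j)

  -- Rooted at r, u belongs to T_w (w and its descendants) iff w lies on
  -- the (unique, in a tree) u–r path.
  InSub : Fin n → Fin n → Fin n → Set
  InSub r w u = ∃ λ p → IsPath u r p × w ∈ p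

  -- Equivalently, {x₁,…,x_k} is a component of G − v
  -- inducing the path x₁…x_k, and v is adjacent (among them) only to x_k.
  PendantPath : Fin n → ℕ → (ℕ → Fin n) → Set
  PendantPath v k x =
      (∀ i j → 1 ≤ i → i ≤ k → 1 ≤ j → j ≤ k → x i ≡ x j → i ≡ j)
    × (∀ i → 1 ≤ i → i ≤ k → x i ≢ v)
    × (∀ i → 1 ≤ i → i ≤ k → ∀ u →
          E (x i) u ⇔ ((2 ≤ i × u ≡ x (pred i)) ⊎ (i < k × u ≡ x (suc i)) ⊎ (i ≡ k × u ≡ v)))

  PSupport : Fin n → ℕ → Set
  PSupport v k = ∃ λ x → PendantPath v k x

  -- v is a (P_i,P_j)-support vertex: two different pendant copies
  -- (different components of G − v, i.e. different leaf ends x₁ ≠ y₁)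
  PPSupport : Fin n → ℕ → ℕ → Set
  PPSupport v i j = Σ (ℕ → Fin n) λ x → Σ (ℕ → Fin n) λ y →
    PendantPath v i x × PendantPath v j y × x 1 ≢ y 1

record Graph : Set₁ where
  field
    V : Set
    A : V → V → Set

InducedIso : {n : ℕ} → FinGraph n → (Fin n → Set) → Graph → Set
InducedIso {n} G S H =
  Σ (V → Fin n) λ f →
      (∀ a b → f a ≡ f b → a ≡ b)
    × (∀ a → S (f a))
    × (∀ u → S u → ∃ λ a → f a ≡ u)
    × (∀ a b → A a b ⇔ E G (f a) (f b))
  where open Graph H

-- (d-1)-subdivision of the star K_{1,t}: centre nothing, and for each
-- leg j : Fin t the path  centre – (j,0) – (j,1) – … – (j,d-1)
-- (the d-1 subdivision vertices (j,0..d-2) followed by the original leaf (j,d-1)).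
SV : ℕ → ℕ → Set
SV t d = Maybe (Fin t × Fin d)

data SEdge (t d : ℕ) : SV t d → SV t d → Set where
  hub : ∀ j (i : Fin d) → toℕ i ≡ 0 → SEdge t d nothing (just (j , i))
  leg : ∀ j (i i' : Fin d) → toℕ i' ≡ suc (toℕ i) → SEdge t d (just (j , i)) (just (j , i'))

SAdj : (t d : ℕ) → SV t d → SV t d → Set
SAdj t d a b = SEdge t d a b ⊎ SEdge t d b a

SubdivStar : ℕ → ℕ → Graph
SubdivStar t d = record { V = SV t d ; A = SAdj t d }

data DAdj (t₁ t₂ d : ℕ) : SV t₁ d ⊎ SV t₂ d → SV t₁ d ⊎ SV t₂ d → Set where
  left   : ∀ a b → SAdj t₁ d a b → DAdj t₁ t₂ d (Data.Sum.inj₁ a) (Data.Sum.inj₁ b)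
  right  : ∀ a b → SAdj t₂ d a b → DAdj t₁ t₂ d (Data.Sum.inj₂ a) (Data.Sum.inj₂ b)
  bridge₁ : DAdj t₁ t₂ d (Data.Sum.inj₁ nothing) (Data.Sum.inj₂ nothing)
  bridge₂ : DAdj t₁ t₂ d (Data.Sum.inj₂ nothing) (Data.Sum.inj₁ nothing)

DoubleSubdivStar : ℕ → ℕ → ℕ → Graph
DoubleSubdivStar t₁ t₂ d = record { V = SV t₁ d ⊎ SV t₂ d ; A = DAdj t₁ t₂ d }

-- Root T at v_{s+1} and compare depths.  Below any non-root vertex y, the subtree
-- T_y is either a leg (a hanging path) of at most d vertices, or it contains a
-- branching vertex and reaches d levels below y: a longer leg would be a pendant
-- P_{d+1} at the parent of y, and two sibling legs that are not both of length d
-- form a forbidden (P_i, P_j) pair.  Subtrees hanging off v_2, …, v_{d+1} are too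
-- shallow to be deep, since v_1 is at depth s.  Hence v_2, …, v_d have no children
-- off the path, every child of v_{d+1} heads a leg of exactly d vertices, and
-- v_{d+1} has at least two children because a single leg below it would be a
-- pendant P_{d+1} at v_{d+2}: T_{v_{d+1}} is a subdivided star.  Reversing the path
-- gives the other end, and for s = 2d + 1 the stars at v_{d+1} and v_{d+2} cover T
-- and are joined only by the edge between their centres.

module Submission where

open import Defs
open import Data.Nat using (ℕ; zero; suc; _+_; _*_; _∸_; _≤_; _<_; z≤n; s≤s; pred; _≤?_; _≟_)
open import Data.Nat.Properties
open import Data.Fin using (Fin; toℕ; fromℕ<; inject₁) renaming (zero to fzero; suc to fsuc)
open import Data.Fin.Properties using (toℕ-injective; toℕ<n; toℕ-fromℕ<; toℕ-inject₁) renaming (_≟_ to _≟ᶠ_)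
open import Data.Bool using (true; false; if_then_else_)
open import Data.Bool.Properties using () renaming (_≟_ to _≟ᵇ_)
open import Data.Maybe using (just; nothing)
open import Data.Maybe.Relation.Binary.Connected using (just) renaming (Connected to MaybeConnected)
import Data.Maybe.Properties as Maybe
open import Data.List
  using (List; []; _∷_; _++_; _∷ʳ_; [_]; length; head; last; reverse; allFin; map; filter; lookup; cartesianProductWith; applyUpTo)
open import Data.List.Properties using (length-++; unfold-reverse; reverse-involutive; length-applyUpTo; applyUpTo-∷ʳ)
open import Data.Nat.ListAction using (sum)
open import Data.List.Relation.Unary.Linked using (Linked; []; [-]; _∷_; linked?)
import Data.List.Relation.Unary.Linked as Linked
import Data.List.Relation.Unary.Linked.Properties as Linked
open import Data.List.Relation.Unary.All using (All; []; _∷_)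
import Data.List.Relation.Unary.All as All
import Data.List.Relation.Unary.All.Properties as All
open import Data.List.Relation.Unary.Any using (Any; here; there; any?)
import Data.List.Relation.Unary.Any as Any
import Data.List.Relation.Unary.Any.Properties as AnyP
open import Data.List.Membership.Propositional using (_∈_; _∉_; find; lose)
open import Data.List.Membership.Propositional.Properties
  using (∈-allFin; ∈-filter⁺; ∈-filter⁻; ∈-cartesianProductWith⁺; ∈-cartesianProductWith⁻; ∈-∃++; ∈-++⁻; ∈-++⁺ʳ; ∈-lookup; ∈-applyUpTo⁺)
open import Data.List.Relation.Unary.Unique.Propositional using (Unique; []; _∷_)
import Data.List.Relation.Unary.Unique.Propositional.Properties as Unique
open import Data.Product using (Σ; ∃; ∃₂; _×_; _,_; proj₁; proj₂)
open import Data.Sum using (_⊎_; inj₁; inj₂)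
import Data.Sum as Sum
open import Data.Empty using (⊥; ⊥-elim)
open import Data.Unit using (⊤; tt)
open import Function using (_∘_)
open import Relation.Nullary using (¬_; Dec; yes; no; contradiction)
open import Relation.Nullary.Decidable using (_×-dec_)
open import Relation.Unary using (Decidable)
open import Relation.Binary using (Symmetric)
open import Relation.Binary.Definitions using (tri<; tri≈; tri>)
open import Relation.Binary.PropositionalEquality
  using (_≡_; _≢_; refl; sym; trans; cong; cong₂; subst; subst₂; module ≡-Reasoning)
open import Function.Bundles using (_⇔_; mk⇔; module Equivalence)

module _ {A : Set} where

  last-∷ʳ : ∀ (xs : List A) x → last (xs ∷ʳ x) ≡ just x
  last-∷ʳ []           x = refl
  last-∷ʳ (_ ∷ [])     x = refl
  last-∷ʳ (_ ∷ y ∷ xs) x = last-∷ʳ (y ∷ xs) x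

  last-++-∷ : ∀ (xs : List A) y ys → last (xs ++ y ∷ ys) ≡ last (y ∷ ys)
  last-++-∷ []           y ys = refl
  last-++-∷ (_ ∷ [])     y ys = refl
  last-++-∷ (_ ∷ x ∷ xs) y ys = last-++-∷ (x ∷ xs) y ys

  last-reverse : ∀ (xs : List A) → last (reverse xs) ≡ head xs
  last-reverse []       = refl
  last-reverse (x ∷ xs) = trans (cong last (unfold-reverse x xs)) (last-∷ʳ (reverse xs) x)

  head-reverse : ∀ (xs : List A) → head (reverse xs) ≡ last xs
  head-reverse xs = trans (sym (last-reverse (reverse xs))) (cong last (reverse-involutive xs))

  ∈-head : ∀ {xs : List A} {x} → head xs ≡ just x → x ∈ xs
  ∈-head {_ ∷ _} refl = here refl

  ∈-last : ∀ {xs : List A} {x} → last xs ≡ just x → x ∈ xs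
  ∈-last {_ ∷ []}     refl = here refl
  ∈-last {_ ∷ y ∷ xs} eq   = there (∈-last {y ∷ xs} eq)

  module _ {R : A → A → Set} where

    Linked-reverse : Symmetric R → ∀ {xs} → Linked R xs → Linked R (reverse xs)
    Linked-reverse R-sym             []      = []
    Linked-reverse R-sym             [-]     = [-]
    Linked-reverse R-sym {x ∷ y ∷ xs} (r ∷ l) =
      subst (Linked R) (sym (unfold-reverse x (y ∷ xs)))
        (Linked.++⁺ (Linked-reverse R-sym l) connect [-])
      where
        connect : MaybeConnected R (last (reverse (y ∷ xs))) (just x)
        connect = subst (λ z → MaybeConnected R z (just x)) (sym (last-reverse (y ∷ xs))) (just (R-sym r))

    Linked-++-∷⁻ˡ : ∀ xs {y ys} → Linked R (xs ++ y ∷ ys) → Linked R (xs ∷ʳ y)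
    Linked-++-∷⁻ˡ []           _       = [-]
    Linked-++-∷⁻ˡ (_ ∷ [])     (r ∷ _) = r ∷ [-]
    Linked-++-∷⁻ˡ (_ ∷ x ∷ xs) (r ∷ l) = r ∷ Linked-++-∷⁻ˡ (x ∷ xs) l

    Linked-++⁻ʳ : ∀ xs {ys} → Linked R (xs ++ ys) → Linked R ys
    Linked-++⁻ʳ []       l = l
    Linked-++⁻ʳ (_ ∷ xs) l = Linked-++⁻ʳ xs (Linked.tail l)

    Linked-++-∷⁺ : ∀ xs {y ys} → Linked R (xs ∷ʳ y) → Linked R (y ∷ ys) → Linked R (xs ++ y ∷ ys)
    Linked-++-∷⁺ []           _        l = l
    Linked-++-∷⁺ (_ ∷ [])     (r ∷ _)  l = r ∷ l
    Linked-++-∷⁺ (_ ∷ x ∷ xs) (r ∷ l′) l = r ∷ Linked-++-∷⁺ (x ∷ xs) l′ l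

  Unique-++⁻ˡ : ∀ (xs : List A) {ys} → Unique (xs ++ ys) → Unique xs
  Unique-++⁻ˡ []       _       = []
  Unique-++⁻ˡ (_ ∷ xs) (a ∷ u) = All.++⁻ˡ xs a ∷ Unique-++⁻ˡ xs u

  Unique-++⁻ʳ : ∀ (xs : List A) {ys} → Unique (xs ++ ys) → Unique ys
  Unique-++⁻ʳ []       u       = u
  Unique-++⁻ʳ (_ ∷ xs) (_ ∷ u) = Unique-++⁻ʳ xs u

  Unique-++-disjoint : ∀ (xs : List A) {ys x} → Unique (xs ++ ys) → x ∈ xs → x ∉ ys
  Unique-++-disjoint (_ ∷ xs) (x∉ ∷ _) (here refl) x∈ys = All.lookup x∉ (∈-++⁺ʳ xs x∈ys) refl
  Unique-++-disjoint (_ ∷ xs) (_ ∷ u)  (there x∈)  x∈ys = Unique-++-disjoint xs u x∈ x∈ys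

  Unique-reverse : ∀ {xs : List A} → Unique xs → Unique (reverse xs)
  Unique-reverse {[]}     []         = []
  Unique-reverse {x ∷ xs} (x∉xs ∷ u) =
    subst Unique (sym (unfold-reverse x xs))
      (Unique.++⁺ (Unique-reverse u) ([] ∷ [])
        λ { (x∈ , here refl) → All.lookup x∉xs (AnyP.reverse⁻ x∈) refl })

  Unique-lookup-injective : ∀ {xs : List A} → Unique xs → ∀ {i j} → lookup xs i ≡ lookup xs j → i ≡ j
  Unique-lookup-injective {_ ∷ _}  _         {fzero}  {fzero}  _  = refl
  Unique-lookup-injective {_ ∷ _}  (x∉ ∷ _)  {fzero}  {fsuc j} eq = ⊥-elim (All.lookup x∉ (∈-lookup j) eq)
  Unique-lookup-injective {_ ∷ _}  (x∉ ∷ _)  {fsuc i} {fzero}  eq = ⊥-elim (All.lookup x∉ (∈-lookup i) (sym eq))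
  Unique-lookup-injective {_ ∷ _}  (_ ∷ u)   {fsuc i} {fsuc j} eq = cong fsuc (Unique-lookup-injective u eq)

  split-at-first : ∀ {P : A → Set} → Decidable P → ∀ {xs} → Any P xs →
                   ∃₂ λ ys z → ∃ λ zs → xs ≡ ys ++ z ∷ zs × P z × All (¬_ ∘ P) ys
  split-at-first P? {x ∷ xs} any with P? x | any
  ... | yes Px | _          = [] , x , xs , refl , Px , []
  ... | no ¬Px | here Px    = contradiction Px ¬Px
  ... | no ¬Px | there any′ with split-at-first P? any′
  ...   | ys , z , zs , refl , Pz , ¬Pys = x ∷ ys , z , zs , refl , Pz , ¬Px ∷ ¬Pys

  2≤length : ∀ {xs : List A} {a b} → a ∈ xs → b ∈ xs → a ≢ b → 2 ≤ length xs
  2≤length {_ ∷ _ ∷ _} _           _           _   = s≤s (s≤s z≤n)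
  2≤length {_ ∷ []}    (here refl) (here refl) a≢b = contradiction refl a≢b

  3≤length : ∀ {xs : List A} {a b c} → a ∈ xs → b ∈ xs → c ∈ xs → a ≢ b → a ≢ c → b ≢ c →
             3 ≤ length xs
  3≤length {_ ∷ _ ∷ _ ∷ _} _ _ _ _ _ _ = s≤s (s≤s (s≤s z≤n))
  3≤length {_ ∷ []}     (here refl)         (here refl)         _                   a≢b _   _   = contradiction refl a≢b
  3≤length {_ ∷ _ ∷ []} (here refl)         (here refl)         _                   a≢b _   _   = contradiction refl a≢b
  3≤length {_ ∷ _ ∷ []} (there (here refl)) (there (here refl)) _                   a≢b _   _   = contradiction refl a≢b
  3≤length {_ ∷ _ ∷ []} (here refl)         (there (here refl)) (here refl)         _   a≢c _   = contradiction refl a≢c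
  3≤length {_ ∷ _ ∷ []} (here refl)         (there (here refl)) (there (here refl)) _   _   b≢c = contradiction refl b≢c
  3≤length {_ ∷ _ ∷ []} (there (here refl)) (here refl)         (here refl)         _   _   b≢c = contradiction refl b≢c
  3≤length {_ ∷ _ ∷ []} (there (here refl)) (here refl)         (there (here refl)) _   a≢c _   = contradiction refl a≢c

  3≤length⇒distinct : ∀ {xs : List A} → Unique xs → 3 ≤ length xs →
                      ∃₂ λ a b → ∃ λ c → a ∈ xs × b ∈ xs × c ∈ xs × a ≢ b × a ≢ c × b ≢ c
  3≤length⇒distinct {a ∷ b ∷ c ∷ _} ((a≢b ∷ a≢c ∷ _) ∷ (b≢c ∷ _) ∷ _) _ =
    a , b , c , here refl , there (here refl) , there (there (here refl)) , a≢b , a≢c , b≢c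
  3≤length⇒distinct {_ ∷ []}     _ (s≤s ())
  3≤length⇒distinct {_ ∷ _ ∷ []} _ (s≤s (s≤s ()))

  -- Pigeonhole: three distinct members cannot all lie in {a, b}.
  length≡2 : ∀ {xs : List A} {a b} → Unique xs → a ∈ xs → b ∈ xs → a ≢ b →
             (∀ {u} → u ∈ xs → u ≡ a ⊎ u ≡ b) → length xs ≡ 2
  length≡2 {xs} u a∈ b∈ a≢b only = ≤-antisym (≮⇒≥ ¬3≤) (2≤length a∈ b∈ a≢b)
    where
      ¬3≤ : ¬ 2 < length xs
      ¬3≤ 3≤ with 3≤length⇒distinct u 3≤
      ... | p , q , s , p∈ , q∈ , s∈ , p≢q , p≢s , q≢s with only p∈ | only q∈ | only s∈
      ...   | inj₁ refl | inj₁ refl | _         = p≢q refl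
      ...   | inj₂ refl | inj₂ refl | _         = p≢q refl
      ...   | inj₁ refl | inj₂ refl | inj₁ refl = p≢s refl
      ...   | inj₁ refl | inj₂ refl | inj₂ refl = q≢s refl
      ...   | inj₂ refl | inj₁ refl | inj₁ refl = q≢s refl
      ...   | inj₂ refl | inj₁ refl | inj₂ refl = p≢s refl

-- Paths, distances and degrees in finite graphs

least-witness : ∀ {P : ℕ → Set} → Decidable P → ∀ {n} → P n → ∃ λ m → P m × (∀ {k} → k < m → ¬ P k)
least-witness P? {n} Pn with P? 0
... | yes P0 = 0 , P0 , λ ()
least-witness P? {zero}  Pn | no ¬P0 = contradiction Pn ¬P0
least-witness P? {suc n} Pn | no ¬P0 with least-witness (P? ∘ suc) Pn
... | m , Pm , below = suc m , Pm , λ { {zero} _ → ¬P0 ; {suc k} (s≤s k<m) → below k<m }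

module FinGraphProperties {n : ℕ} (G : FinGraph n) where
  open import Data.List.Membership.DecPropositional (_≟ᶠ_ {n}) using (_∈?_)
  open import Data.List.Relation.Unary.Unique.DecPropositional (_≟ᶠ_ {n}) using (unique?)
  open FinGraph G using (adj) renaming (sym to adj-sym; irrefl to adj-irrefl)

  V : Set
  V = Fin n

  E-sym : ∀ {a b} → E G a b → E G b a
  E-sym {a} {b} e = trans (adj-sym b a) e

  E-irrefl : ∀ {a} → ¬ E G a a
  E-irrefl {a} e with trans (sym e) (adj-irrefl a)
  ... | ()

  E? : ∀ a b → Dec (E G a b)
  E? a b = adj a b ≟ᵇ true

  IsPath? : ∀ u w p → Dec (IsPath G u w p)
  IsPath? u w p = linked? E? p ×-dec unique? p
    ×-dec Maybe.≡-dec _≟ᶠ_ (head p) (just u) ×-dec Maybe.≡-dec _≟ᶠ_ (last p) (just w)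

  IsPath-reverse : ∀ {u w p} → IsPath G u w p → IsPath G w u (reverse p)
  IsPath-reverse {p = p} (l , un , hd , la) =
    Linked-reverse E-sym l , Unique-reverse un ,
    trans (head-reverse p) la , trans (last-reverse p) hd

  IsPath-∷ : ∀ {a b w p} → E G b a → b ∉ p → IsPath G a w p → IsPath G b w (b ∷ p)
  IsPath-∷ {p = _ ∷ _} e b∉p (l , un , refl , la) = e ∷ l , All.¬Any⇒All¬ _ b∉p ∷ un , refl , la

  IsPath-suffix : ∀ {u w x p} → IsPath G u w p → x ∈ p → ∃ λ q → IsPath G x w q × length q ≤ length p
  IsPath-suffix (l , un , _ , la) x∈p with ∈-∃++ x∈p
  ... | ys , zs , refl =
    _ , (Linked-++⁻ʳ ys l , Unique-++⁻ʳ ys un , refl , trans (sym (last-++-∷ ys _ zs)) la) ,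
    subst (_ ≤_) (sym (length-++ ys)) (m≤n+m _ (length ys))

  -- Follow p from a until it first meets q, then follow q to b.
  detour : ∀ {a b w p q} → IsPath G a w p → IsPath G w b q → a ∉ q → b ∉ p →
           ∃ λ c → IsPath G a b c × 3 ≤ length c
  detour {a} {b} {p = p} {q} (lp , up , hp , lap) (lq , uq , hq , laq) a∉q b∉p
    with split-at-first (_∈? q) {p} (Any.map (λ { refl → ∈-head hq }) (∈-last lap))
  ... | p₁ , m , p₂ , refl , m∈q , p₁∉q with ∈-∃++ m∈q
  ... | q₁ , q₂ , refl with p₁ | q₂ | hp
  ...   | []       | _       | refl = contradiction m∈q a∉q
  ...   | p₁       | []      | _    =
    contradiction (∈-++⁺ʳ p₁ (here (Maybe.just-injective (trans (sym laq) (last-++-∷ q₁ m []))))) b∉p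
  ...   | a′ ∷ p₁′ | z ∷ q₂′ | refl =
    c , (Linked-++-∷⁺ (a ∷ p₁′) (Linked-++-∷⁻ˡ (a ∷ p₁′) lp) (Linked-++⁻ʳ q₁ lq) ,
         Unique.++⁺ (Unique-++⁻ˡ (a ∷ p₁′) up) (Unique-++⁻ʳ q₁ uq) disjoint ,
         refl , trans (last-++-∷ (a ∷ p₁′) m (z ∷ q₂′)) (trans (sym (last-++-∷ q₁ m (z ∷ q₂′))) laq)) ,
    s≤s (subst (2 ≤_) (sym (length-++ p₁′)) (≤-trans (s≤s (s≤s z≤n)) (m≤n+m _ (length p₁′))))
    where
      c = a ∷ p₁′ ++ m ∷ z ∷ q₂′
      disjoint : ∀ {x} → x ∈ a ∷ p₁′ × x ∈ m ∷ z ∷ q₂′ → ⊥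
      disjoint (x∈p₁ , x∈q₂) = All.lookup p₁∉q x∈p₁ (∈-++⁺ʳ q₁ x∈q₂)

  listsOfLength : ℕ → List (List V)
  listsOfLength zero    = [ [] ]
  listsOfLength (suc m) = cartesianProductWith _∷_ (allFin n) (listsOfLength m)

  ∈-listsOfLength⁺ : ∀ p → p ∈ listsOfLength (length p)
  ∈-listsOfLength⁺ []      = here refl
  ∈-listsOfLength⁺ (x ∷ p) = ∈-cartesianProductWith⁺ _∷_ (∈-allFin x) (∈-listsOfLength⁺ p)

  ∈-listsOfLength⁻ : ∀ m {p} → p ∈ listsOfLength m → length p ≡ m
  ∈-listsOfLength⁻ zero    (here refl) = refl
  ∈-listsOfLength⁻ (suc m) p∈ with ∈-cartesianProductWith⁻ _∷_ (allFin n) (listsOfLength m) p∈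
  ... | _ , _ , _ , p′∈ , refl = cong suc (∈-listsOfLength⁻ m p′∈)

  PathOfLength : V → V → ℕ → Set
  PathOfLength u w k = ∃ λ p → IsPath G u w p × length p ≡ suc k

  PathOfLength? : ∀ u w → Decidable (PathOfLength u w)
  PathOfLength? u w k with any? (IsPath? u w) (listsOfLength (suc k))
  ... | yes found with find found
  ...   | p , p∈ , path = yes (p , path , ∈-listsOfLength⁻ (suc k) p∈)
  PathOfLength? u w k | no none =
    no λ (p , path , len) → none (lose (subst (λ m → p ∈ listsOfLength m) len (∈-listsOfLength⁺ p)) path)

  abstract
    dist-exists : Defs.Connected G → ∀ u w → ∃ (Dist G u w)
    dist-exists connected u w with connected u w
    ... | x ∷ p , path with least-witness (PathOfLength? u w) (x ∷ p , path , refl)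
    ...   | m , shortest , below = m , shortest , minimal
      where
        minimal : ∀ q → IsPath G u w q → suc m ≤ length q
        minimal (y ∷ q) path′ = s≤s (≮⇒≥ λ q<m → below q<m (y ∷ q , path′ , refl))

  neighbours : V → List V
  neighbours v = filter (E? v) (allFin n)

  deg≡length-neighbours : ∀ v → deg G v ≡ length (neighbours v)
  deg≡length-neighbours v = go (allFin n)
    where
      go : ∀ xs → sum (map (λ u → if adj v u then 1 else 0) xs) ≡ length (filter (E? v) xs)
      go []       = refl
      go (x ∷ xs) with adj v x | E? v x
      ... | true  | yes _ = cong suc (go xs)
      ... | true  | no ¬e = contradiction refl ¬e
      ... | false | no _  = go xs
      ... | false | yes ()

  Unique-neighbours : ∀ v → Unique (neighbours v)
  Unique-neighbours v = Unique.filter⁺ (E? v) (Unique.allFin⁺ n)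

  ∈-neighbours⁺ : ∀ {v u} → E G v u → u ∈ neighbours v
  ∈-neighbours⁺ {v} {u} = ∈-filter⁺ (E? v) (∈-allFin u)

  ∈-neighbours⁻ : ∀ {v u} → u ∈ neighbours v → E G v u
  ∈-neighbours⁻ {v} u∈ = proj₂ (∈-filter⁻ (E? v) {xs = allFin n} u∈)

  3≤deg : ∀ {v a b c} → E G v a → E G v b → E G v c → a ≢ b → a ≢ c → b ≢ c → 3 ≤ deg G v
  3≤deg {v} va vb vc a≢b a≢c b≢c = subst (3 ≤_) (sym (deg≡length-neighbours v))
    (3≤length (∈-neighbours⁺ va) (∈-neighbours⁺ vb) (∈-neighbours⁺ vc) a≢b a≢c b≢c)

  3≤deg⇒neighbours : ∀ {v} → 3 ≤ deg G v →
                     ∃₂ λ a b → ∃ λ c → E G v a × E G v b × E G v c × a ≢ b × a ≢ c × b ≢ c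
  3≤deg⇒neighbours {v} 3≤ with 3≤length⇒distinct (Unique-neighbours v) (subst (3 ≤_) (deg≡length-neighbours v) 3≤)
  ... | a , b , c , a∈ , b∈ , c∈ , distinct =
    a , b , c , ∈-neighbours⁻ a∈ , ∈-neighbours⁻ b∈ , ∈-neighbours⁻ c∈ , distinct

  deg≡2 : ∀ {v a b} → E G v a → E G v b → a ≢ b → (∀ u → E G v u → u ≡ a ⊎ u ≡ b) → deg G v ≡ 2
  deg≡2 {v} va vb a≢b only = trans (deg≡length-neighbours v)
    (length≡2 (Unique-neighbours v) (∈-neighbours⁺ va) (∈-neighbours⁺ vb) a≢b (only _ ∘ ∈-neighbours⁻))

  detour-¬closing-edge : Acyclic G → ∀ {a b w p q} → IsPath G a w p → IsPath G w b q → a ∉ q → b ∉ p → ¬ E G b a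
  detour-¬closing-edge acyclic p-path q-path a∉q b∉p e with detour p-path q-path a∉q b∉p
  ... | c , (l , un , hd , la) , 3≤c = acyclic c (3≤c , l , un , _ , _ , hd , la , e)

  glue-SubdivStars : ∀ {S₁ S₂ : V → Set} {t₁ t₂ d}
    (iso₁ : InducedIso G S₁ (SubdivStar t₁ d)) (iso₂ : InducedIso G S₂ (SubdivStar t₂ d)) →
    (∀ u → S₁ u ⊎ S₂ u) → (∀ {u} → S₁ u → S₂ u → ⊥) →
    (∀ {a b} → S₁ a → S₂ b → E G a b → a ≡ proj₁ iso₁ nothing × b ≡ proj₁ iso₂ nothing) →
    E G (proj₁ iso₁ nothing) (proj₁ iso₂ nothing) →
    InducedIso G (λ _ → ⊤) (DoubleSubdivStar t₁ t₂ d)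
  glue-SubdivStars {S₁} {S₂} {t₁} {t₂} {d} (f₁ , f₁-injective , f₁-into , f₁-onto , f₁-adj)
                   (f₂ , f₂-injective , f₂-into , f₂-onto , f₂-adj) cover disjoint crossing bridge =
    F , F-injective , (λ _ → tt) , F-onto , F-adjacency
    where
      open Equivalence using (to; from)

      F : SV t₁ d ⊎ SV t₂ d → V
      F = Sum.[ f₁ , f₂ ]

      F-injective : ∀ a b → F a ≡ F b → a ≡ b
      F-injective (inj₁ a) (inj₁ b) eq = cong inj₁ (f₁-injective a b eq)
      F-injective (inj₂ a) (inj₂ b) eq = cong inj₂ (f₂-injective a b eq)
      F-injective (inj₁ a) (inj₂ b) eq = ⊥-elim (disjoint (f₁-into a) (subst S₂ (sym eq) (f₂-into b)))
      F-injective (inj₂ a) (inj₁ b) eq = ⊥-elim (disjoint (f₁-into b) (subst S₂ eq (f₂-into a)))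

      F-onto : ∀ u → ⊤ → ∃ λ a → F a ≡ u
      F-onto u _ with cover u
      ... | inj₁ u∈S₁ = let a , fa≡u = f₁-onto u u∈S₁ in inj₁ a , fa≡u
      ... | inj₂ u∈S₂ = let a , fa≡u = f₂-onto u u∈S₂ in inj₂ a , fa≡u

      centres : ∀ a b → E G (f₁ a) (f₂ b) → a ≡ nothing × b ≡ nothing
      centres a b e with crossing (f₁-into a) (f₂-into b) e
      ... | a≡ , b≡ = f₁-injective a nothing a≡ , f₂-injective b nothing b≡

      bridge₁-only : ∀ a b → E G (f₁ a) (f₂ b) → DAdj t₁ t₂ d (inj₁ a) (inj₂ b)
      bridge₁-only a b e with centres a b e
      ... | refl , refl = bridge₁

      bridge₂-only : ∀ a b → E G (f₂ b) (f₁ a) → DAdj t₁ t₂ d (inj₂ b) (inj₁ a)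
      bridge₂-only a b e with centres a b (E-sym e)
      ... | refl , refl = bridge₂

      F-adjacency : ∀ a b → DAdj t₁ t₂ d a b ⇔ E G (F a) (F b)
      F-adjacency (inj₁ a) (inj₁ b) = mk⇔ (λ { (left _ _ ab) → to (f₁-adj a b) ab }) (left a b ∘ from (f₁-adj a b))
      F-adjacency (inj₂ a) (inj₂ b) = mk⇔ (λ { (right _ _ ab) → to (f₂-adj a b) ab }) (right a b ∘ from (f₂-adj a b))
      F-adjacency (inj₁ a) (inj₂ b) = mk⇔ (λ { bridge₁ → bridge }) (bridge₁-only a b)
      F-adjacency (inj₂ b) (inj₁ a) = mk⇔ (λ { bridge₂ → E-sym bridge }) (bridge₂-only a b)

StarAt : ∀ {n} → FinGraph n → (Fin n → Set) → Fin n → ℕ → Set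
StarAt T S w d = Σ ℕ λ t → 2 ≤ t × Σ (InducedIso T S (SubdivStar t d)) λ iso → proj₁ iso nothing ≡ w

StarAt⇒InducedIso : ∀ {n} (T : FinGraph n) {S w d} → StarAt T S w d →
                    ∃ λ t → 2 ≤ t × InducedIso T S (SubdivStar t d)
StarAt⇒InducedIso T (t , 2≤t , iso , _) = t , 2≤t , iso

DoubleStar : ∀ {n} → FinGraph n → ℕ → Set
DoubleStar T d = Σ ℕ λ t₁ → Σ ℕ λ t₂ → 2 ≤ t₁ × 2 ≤ t₂ × InducedIso T (λ _ → ⊤) (DoubleSubdivStar t₁ t₂ d)

-- Trees rooted at a vertex

module Rooted {n : ℕ} (T : FinGraph n) (tree : IsTree T) (r : Fin n) where
  open FinGraphProperties T public
  open import Data.List.Membership.DecPropositional (_≟ᶠ_ {n}) using (_∈?_)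

  private
    connected = proj₁ tree
    acyclic   = proj₂ tree

  depth : V → ℕ
  depth u = proj₁ (dist-exists connected u r)

  depth-Dist : ∀ u → Dist T u r (depth u)
  depth-Dist u = proj₂ (dist-exists connected u r)

  toRoot : V → List V
  toRoot u = proj₁ (proj₁ (depth-Dist u))

  toRoot-path : ∀ u → IsPath T u r (toRoot u)
  toRoot-path u = proj₁ (proj₂ (proj₁ (depth-Dist u)))

  length-toRoot : ∀ u → length (toRoot u) ≡ suc (depth u)
  length-toRoot u = proj₂ (proj₂ (proj₁ (depth-Dist u)))

  depth-minimal : ∀ {u} p → IsPath T u r p → suc (depth u) ≤ length p
  depth-minimal {u} = proj₂ (depth-Dist u)

  depth-root : depth r ≡ 0
  depth-root = n≤0⇒n≡0 (≤-pred (depth-minimal (r ∷ []) ([-] , [] ∷ [] , refl , refl)))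

  depth-on-path : ∀ {u y p} → IsPath T u r p → y ∈ p → suc (depth y) ≤ length p
  depth-on-path path y∈p with IsPath-suffix path y∈p
  ... | q , q-path , q≤p = ≤-trans (depth-minimal q q-path) q≤p

  ∉-toRoot : ∀ {u y} → y ≢ u → depth u ≤ depth y → y ∉ toRoot u
  ∉-toRoot {u} {y} y≢u u≤y = go (toRoot-path u) (length-toRoot u)
    where
      go : ∀ {p} → IsPath T u r p → length p ≡ suc (depth u) → y ∉ p
      go (_ , _ , refl , _)                      _   (here y≡u) = y≢u y≡u
      go {_ ∷ _ ∷ _} (_ ∷ l , _ ∷ un , refl , la) len (there y∈) =
        <⇒≱ (≤-trans (depth-on-path (l , un , refl , la) y∈) (≤-reflexive (suc-injective len))) u≤y

  ∉-fromRoot : ∀ {u y} → y ≢ u → depth u ≤ depth y → y ∉ reverse (toRoot u)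
  ∉-fromRoot y≢u u≤y = ∉-toRoot y≢u u≤y ∘ AnyP.reverse⁻

  depth-adjacent : ∀ {a b} → E T a b → depth b ≤ suc (depth a)
  depth-adjacent {a} {b} e with b ∈? toRoot a
  ... | yes b∈ = m≤n⇒m≤1+n (≤-pred (≤-trans (depth-on-path (toRoot-path a) b∈) (≤-reflexive (length-toRoot a))))
  ... | no b∉  = ≤-pred (≤-trans (depth-minimal _ (IsPath-∷ (E-sym e) b∉ (toRoot-path a)))
                                 (≤-reflexive (cong suc (length-toRoot a))))

  -- Otherwise a's path to the root and b's path back down close a cycle with the edge.
  depth-adjacent-≢ : ∀ {a b} → E T a b → depth a ≢ depth b
  depth-adjacent-≢ {a} {b} e a≡b =
    detour-¬closing-edge acyclic (toRoot-path a) (IsPath-reverse (toRoot-path b))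
      (∉-fromRoot a≢b (≤-reflexive (sym a≡b))) (∉-toRoot (a≢b ∘ sym) (≤-reflexive a≡b)) (E-sym e)
    where
      a≢b : a ≢ b
      a≢b refl = E-irrefl e

  Child : V → V → Set
  Child c p = E T c p × depth c ≡ suc (depth p)

  child? : ∀ c p → Dec (Child c p)
  child? c p = E? c p ×-dec (depth c ≟ suc (depth p))

  ¬Child-root : ∀ {p} → ¬ Child r p
  ¬Child-root (_ , eq) = 0≢1+n (trans (sym depth-root) eq)

  -- Otherwise u, a's path to the root and b's path back down close a cycle.
  parent-unique : ∀ {u a b} → Child u a → Child u b → a ≡ b
  parent-unique {u} {a} {b} (ua , u≡1+a) (ub , u≡1+b) with a ≟ᶠ b
  ... | yes a≡b = a≡b
  ... | no  a≢b = contradiction (E-sym ub)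
        (detour-¬closing-edge acyclic (IsPath-∷ ua (∉-toRoot u≢a a≤u) (toRoot-path a)) (IsPath-reverse (toRoot-path b))
          (∉-fromRoot u≢b b≤u) b∉)
    where
      a≡b : depth a ≡ depth b
      a≡b = suc-injective (trans (sym u≡1+a) u≡1+b)
      a≤u : depth a ≤ depth u
      a≤u = ≤-trans (n≤1+n _) (≤-reflexive (sym u≡1+a))
      b≤u : depth b ≤ depth u
      b≤u = ≤-trans (n≤1+n _) (≤-reflexive (sym u≡1+b))
      u≢a : u ≢ a
      u≢a refl = 1+n≢n (sym u≡1+a)
      u≢b : u ≢ b
      u≢b refl = 1+n≢n (sym u≡1+b)
      b∉ : b ∉ u ∷ toRoot a
      b∉ (here b≡u) = u≢b (sym b≡u)
      b∉ (there b∈) = ∉-toRoot (a≢b ∘ sym) (≤-reflexive a≡b) b∈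

  edge⇒Child : ∀ {a b} → E T a b → Child a b ⊎ Child b a
  edge⇒Child {a} {b} e with <-cmp (depth a) (depth b)
  ... | tri< a<b _ _ = inj₂ (E-sym e , ≤-antisym (depth-adjacent e) a<b)
  ... | tri≈ _ a≡b _ = contradiction a≡b (depth-adjacent-≢ e)
  ... | tri> _ _ a>b = inj₁ (e , ≤-antisym (depth-adjacent (E-sym e)) a>b)

  Child⇒≢parent : ∀ {c u p} → Child c u → Child u p → c ≢ p
  Child⇒≢parent (_ , c≡1+u) (_ , u≡1+p) refl = <⇒≢ (m<n⇒m<1+n (n<1+n _)) (trans c≡1+u (cong suc u≡1+p))

  data Desc (w : V) : V → Set where
    self : Desc w w
    down : ∀ {p c} → Desc w p → Child c p → Desc w c

  Desc-depth : ∀ {x y} → Desc x y → depth x ≤ depth y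
  Desc-depth self              = ≤-refl
  Desc-depth (down d (_ , eq)) = ≤-trans (Desc-depth d) (≤-trans (n≤1+n _) (≤-reflexive (sym eq)))

  Desc-trans : ∀ {x y z} → Desc x y → Desc y z → Desc x z
  Desc-trans d self        = d
  Desc-trans d (down d′ c) = down (Desc-trans d d′) c

  Desc-child : ∀ {c p} → Child c p → Desc p c
  Desc-child = down self

  Desc-same-depth : ∀ {x y} → Desc x y → depth x ≡ depth y → x ≡ y
  Desc-same-depth self              _   = refl
  Desc-same-depth (down d (_ , eq)) x≡y = contradiction (trans x≡y eq) (<⇒≢ (s≤s (Desc-depth d)))

  Desc-ancestors-ordered : ∀ {x y z} → Desc x z → Desc y z → depth x ≤ depth y → Desc x y
  Desc-ancestors-ordered d          self              _   = d
  Desc-ancestors-ordered self       (down d (_ , eq)) z≤y =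
    contradiction (≤-trans (≤-trans (s≤s (Desc-depth d)) (≤-reflexive (sym eq))) z≤y) (<-irrefl refl)
  Desc-ancestors-ordered (down d c) (down d′ c′)      x≤y with parent-unique c c′
  ... | refl = Desc-ancestors-ordered d d′ x≤y

  Desc-ancestor-unique : ∀ {x y z} → Desc x z → Desc y z → depth x ≡ depth y → x ≡ y
  Desc-ancestor-unique d d′ eq = Desc-same-depth (Desc-ancestors-ordered d d′ (≤-reflexive eq)) eq

  Desc-edge : ∀ {x a b} → Desc x a → E T a b → Desc x b ⊎ (a ≡ x × Child x b)
  Desc-edge d e with edge⇒Child e
  ... | inj₂ b-child = inj₁ (down d b-child)
  Desc-edge self       e | inj₁ a-child = inj₂ (refl , a-child)
  Desc-edge (down d c) e | inj₁ a-child with parent-unique a-child c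
  ... | refl = inj₁ d

  Desc-split : ∀ {x u} → Desc x u → u ≡ x ⊎ ∃ λ c → Child c x × Desc c u
  Desc-split self       = inj₁ refl
  Desc-split (down d c) with Desc-split d
  ... | inj₁ refl            = inj₂ (_ , c , self)
  ... | inj₂ (c′ , c′x , d′) = inj₂ (c′ , c′x , down d′ c)

  path-to-root-ascends : ∀ {u l} → IsPath T u r l → Linked Child l
  path-to-root-ascends {l = _ ∷ []}    _ = [-]
  path-to-root-ascends {l = u ∷ e ∷ l} (ue ∷ lk , u∉ ∷ un , refl , la)
    with path-to-root-ascends {l = e ∷ l} (lk , un , refl , la) | edge⇒Child ue
  ... | rest | inj₁ u-child = u-child ∷ rest
  path-to-root-ascends {l = _ ∷ _ ∷ []}    (_ , _ , refl , refl)     | _            | inj₂ e-child =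
    contradiction e-child ¬Child-root
  path-to-root-ascends {l = _ ∷ _ ∷ _ ∷ _} (_ , u∉ ∷ _ , refl , _) | e-child′ ∷ _ | inj₂ e-child
    with parent-unique e-child′ e-child
  ... | refl = ⊥-elim (All.lookup u∉ (there (here refl)) refl)

  ascending-length : ∀ {u l} → Linked Child (u ∷ l) → last (u ∷ l) ≡ just r → length (u ∷ l) ≡ suc (depth u)
  ascending-length {l = []}    _          refl = cong suc (sym depth-root)
  ascending-length {l = e ∷ l} (uc ∷ lk) la   = cong suc (trans (ascending-length lk la) (sym (proj₂ uc)))

  path-to-root-length : ∀ {u l} → IsPath T u r l → length l ≡ suc (depth u)
  path-to-root-length {l = _ ∷ _} path@(_ , _ , refl , la) = ascending-length (path-to-root-ascends path) la

  ascending⇒Desc : ∀ {u w l} → Linked Child (u ∷ l) → w ∈ u ∷ l → Desc w u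
  ascending⇒Desc _         (here refl) = self
  ascending⇒Desc (uc ∷ lk) (there w∈)  = down (ascending⇒Desc lk w∈) uc

  Desc⇒∈path-to-root : ∀ {w u l} → Desc w u → IsPath T u r l → w ∈ l
  Desc⇒∈path-to-root {l = _ ∷ _}  self       (_ , _ , refl , _)    = here refl
  Desc⇒∈path-to-root {l = _ ∷ []} (down d c) (_ , _ , refl , refl) = contradiction c ¬Child-root
  Desc⇒∈path-to-root {l = _ ∷ _ ∷ _} (down d c) path@(_ ∷ lk , _ ∷ un , refl , la)
    with path-to-root-ascends path
  ... | c′ ∷ _ with parent-unique c′ c
  ...   | refl = there (Desc⇒∈path-to-root d (lk , un , refl , la))

  InSub⇒Desc : ∀ {w u} → InSub T r w u → Desc w u
  InSub⇒Desc (_ ∷ _ , path@(_ , _ , refl , _) , w∈) = ascending⇒Desc (path-to-root-ascends path) w∈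

  Desc⇒InSub : ∀ {w u} → Desc w u → InSub T r w u
  Desc⇒InSub {u = u} d = toRoot u , toRoot-path u , Desc⇒∈path-to-root d (toRoot-path u)

  walk-from-subtree : ∀ {x a l} → Linked (E T) (a ∷ l) → Desc x a → All (Desc x) (a ∷ l) ⊎ x ∈ a ∷ l
  walk-from-subtree {l = []}    _        d = inj₁ (d ∷ [])
  walk-from-subtree {l = _ ∷ _} (e ∷ lk) d with Desc-edge d e
  ... | inj₂ (refl , _) = inj₂ (here refl)
  ... | inj₁ d′         = Sum.map (d ∷_) there (walk-from-subtree lk d′)

  walk-into-subtree : ∀ {x y z l} → Child x y → Linked (E T) l → last l ≡ just z → Desc x z →
                      All (Desc x) l ⊎ (x ∈ l × y ∈ l)
  walk-into-subtree {l = _ ∷ []}    _  _         refl d = inj₁ (d ∷ [])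
  walk-into-subtree {l = _ ∷ _ ∷ _} xy (ae ∷ lk) la   d with walk-into-subtree xy lk la d
  ... | inj₂ (x∈ , y∈) = inj₂ (there x∈ , there y∈)
  ... | inj₁ (de ∷ ds) with Desc-edge de (E-sym ae)
  ...   | inj₁ da          = inj₁ (da ∷ de ∷ ds)
  ...   | inj₂ (refl , xa) = inj₂ (there (here refl) , here (parent-unique xy xa))

  -- Removing the edge x–y, where y is the parent of x, splits the tree into
  -- T_x (rooted at r) and T_y rooted at any vertex z of T_x.
  module EdgeCut {x y z} (xy : Child x y) (xz : Desc x z) where

    y∉subtree : ¬ Desc x y
    y∉subtree d = <⇒≱ (≤-reflexive (sym (proj₂ xy))) (Desc-depth d)

    x≢y : x ≢ y
    x≢y refl = y∉subtree self

    cover : ∀ u → InSub T r x u ⊎ InSub T z y u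
    cover u with connected u z
    ... | l , path@(lk , _ , hd , la) with walk-into-subtree xy lk la xz
    ...   | inj₂ (_ , y∈) = inj₂ (l , path , y∈)
    ...   | inj₁ all      = inj₁ (Desc⇒InSub (All.lookup all (∈-head hd)))

    disjoint : ∀ {u} → InSub T r x u → InSub T z y u → ⊥
    disjoint in-x (l , (lk , un , hd , la) , y∈l) with ∈-∃++ y∈l
    ... | A , B , refl = Unique-++-disjoint A un (x-before-y A lk hd (InSub⇒Desc in-x)) (there x-after-y)
      where
        x-before-y : ∀ A {u} → Linked (E T) (A ++ y ∷ B) → head (A ++ y ∷ B) ≡ just u → Desc x u → x ∈ A
        x-before-y []       _  refl du = ⊥-elim (y∉subtree du)
        x-before-y (a ∷ A′) lk refl du with walk-from-subtree (Linked-++-∷⁻ˡ (a ∷ A′) lk) du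
        ... | inj₁ all = ⊥-elim (y∉subtree (All.lookup all (∈-++⁺ʳ (a ∷ A′) (here refl))))
        ... | inj₂ x∈ with ∈-++⁻ (a ∷ A′) x∈
        ...   | inj₁ x∈A      = x∈A
        ...   | inj₂ (here eq) = ⊥-elim (x≢y eq)
        x-after-y : x ∈ B
        x-after-y with walk-into-subtree xy (Linked-++⁻ʳ A lk) (trans (sym (last-++-∷ A y B)) la) xz
        ... | inj₁ (dy ∷ _)        = ⊥-elim (y∉subtree dy)
        ... | inj₂ (here eq , _)   = ⊥-elim (x≢y eq)
        ... | inj₂ (there x∈B , _) = x∈B

    crossing : ∀ {a b} → InSub T r x a → InSub T z y b → E T a b → a ≡ x × b ≡ y
    crossing in-x in-y e with Desc-edge (InSub⇒Desc in-x) e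
    ... | inj₁ db         = ⊥-elim (disjoint (Desc⇒InSub db) in-y)
    ... | inj₂ (a≡x , xb) = a≡x , parent-unique xb xy

  Desc-has-parent : ∀ {w c z} → Child c w → Desc c z → ∃ (Child z)
  Desc-has-parent cw self        = _ , cw
  Desc-has-parent _  (down _ zp) = _ , zp

  children : V → List V
  children p = filter (λ c → child? c p) (allFin n)

  Unique-children : ∀ p → Unique (children p)
  Unique-children p = Unique.filter⁺ (λ c → child? c p) (Unique.allFin⁺ n)

  ∈-children⁺ : ∀ {c p} → Child c p → c ∈ children p
  ∈-children⁺ {c} {p} = ∈-filter⁺ (λ c → child? c p) (∈-allFin c)

  ∈-children⁻ : ∀ {c p} → c ∈ children p → Child c p
  ∈-children⁻ {p = p} c∈ = proj₂ (∈-filter⁻ (λ c → child? c p) {xs = allFin n} c∈)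

  Branching : V → Set
  Branching p = ∃₂ λ c₁ c₂ → c₁ ≢ c₂ × Child c₁ p × Child c₂ p

  data ChildrenView (p : V) : Set where
    none : (∀ c → ¬ Child c p) → ChildrenView p
    one  : ∀ {c} → Child c p → (∀ c′ → Child c′ p → c′ ≡ c) → ChildrenView p
    many : Branching p → ChildrenView p

  childrenView : ∀ p → ChildrenView p
  childrenView p with children p | Unique-children p | (λ {c} → ∈-children⁻ {c} {p}) | (λ {c} → ∈-children⁺ {c} {p})
  ... | []          | _               | _  | ∈cs = none λ c cp → case-[] (∈cs cp)
    where
      case-[] : ∀ {c} → c ∉ []
      case-[] ()
  ... | c ∷ []      | _               | cs | ∈cs = one (cs (here refl)) λ { c′ c′p → only (∈cs c′p) }
    where
      only : ∀ {c′} → c′ ∈ c ∷ [] → c′ ≡ c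
      only (here eq) = eq
  ... | c₁ ∷ c₂ ∷ _ | (c₁≢c₂ ∷ _) ∷ _ | cs | _  =
    many (c₁ , c₂ , c₁≢c₂ , cs (here refl) , cs (there (here refl)))

  3≤deg⇒Branching : ∀ {w} → 3 ≤ deg T w → Branching w
  3≤deg⇒Branching 3≤ with 3≤deg⇒neighbours 3≤
  ... | a , b , c , wa , wb , wc , a≢b , a≢c , b≢c with edge⇒Child wa | edge⇒Child wb | edge⇒Child wc
  ...   | inj₁ pa | inj₁ pb | _       = contradiction (parent-unique pa pb) a≢b
  ...   | inj₁ pa | inj₂ _  | inj₁ pc = contradiction (parent-unique pa pc) a≢c
  ...   | inj₁ _  | inj₂ cb | inj₂ cc = b , c , b≢c , cb , cc
  ...   | inj₂ _  | inj₁ pb | inj₁ pc = contradiction (parent-unique pb pc) b≢c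
  ...   | inj₂ ca | inj₁ _  | inj₂ cc = a , c , a≢c , ca , cc
  ...   | inj₂ ca | inj₂ cb | _       = a , b , a≢b , ca , cb

  Branching⇒3≤deg : ∀ {w p} → Branching w → Child w p → 3 ≤ deg T w
  Branching⇒3≤deg (_ , _ , c₁≢c₂ , c₁w , c₂w) wp =
    3≤deg (E-sym (proj₁ c₁w)) (E-sym (proj₁ c₂w)) (proj₁ wp) c₁≢c₂
          (Child⇒≢parent c₁w wp) (Child⇒≢parent c₂w wp)

  -- Leg y L: the subtree T_y is a path of L vertices hanging down from y.
  data Leg : V → ℕ → Set where
    leaf : ∀ {y} → (∀ c → ¬ Child c y) → Leg y 1
    stem : ∀ {y c L} → Child c y → (∀ c′ → Child c′ y → c′ ≡ c) → Leg c L → Leg y (suc L)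

  -- The i-th vertex below the top of the leg (junk for i ≥ L).
  legVertex : ∀ {y L} → Leg y L → ℕ → V
  legVertex {y} _            zero    = y
  legVertex {y} (leaf _)     (suc i) = y
  legVertex     (stem _ _ l) (suc i) = legVertex l i

  Leg-nonempty : ∀ {y L} → Leg y L → 1 ≤ L
  Leg-nonempty (leaf _)     = s≤s z≤n
  Leg-nonempty (stem _ _ _) = s≤s z≤n

  legVertex-Desc : ∀ {y L} (l : Leg y L) {i} → i < L → Desc y (legVertex l i)
  legVertex-Desc l            {zero}  _         = self
  legVertex-Desc (stem c _ l) {suc i} (s≤s i<L) = Desc-trans (Desc-child c) (legVertex-Desc l i<L)

  depth-legVertex : ∀ {y L} (l : Leg y L) {i} → i < L → depth (legVertex l i) ≡ depth y + i
  depth-legVertex {y} l {zero} _ = sym (+-identityʳ (depth y))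
  depth-legVertex {y} (stem {c = c} (_ , c≡1+y) _ l) {suc i} (s≤s i<L) = begin
    depth (legVertex l i) ≡⟨ depth-legVertex l i<L ⟩
    depth c + i           ≡⟨ cong (_+ i) c≡1+y ⟩
    suc (depth y) + i     ≡⟨ sym (+-suc (depth y) i) ⟩
    depth y + suc i       ∎
    where open ≡-Reasoning

  legVertex-Child : ∀ {y L} (l : Leg y L) {i} → suc i < L → Child (legVertex l (suc i)) (legVertex l i)
  legVertex-Child (leaf _)     (s≤s ())
  legVertex-Child (stem c _ _) {zero}  _         = c
  legVertex-Child (stem _ _ l) {suc i} (s≤s i<L) = legVertex-Child l i<L

  legVertex-onto : ∀ {y L u} (l : Leg y L) → Desc y u → ∃ λ i → i < L × legVertex l i ≡ u
  legVertex-onto l d with Desc-split d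
  ... | inj₁ refl = 0 , Leg-nonempty l , refl
  legVertex-onto (leaf childless) d | inj₂ (c , cy , _)  = contradiction cy (childless c)
  legVertex-onto (stem _ only l)  d | inj₂ (c , cy , dc) with only c cy
  ... | refl with legVertex-onto l dc
  ...   | i , i<L , eq = suc i , s≤s i<L , eq

  legVertex-children : ∀ {y L c} (l : Leg y L) {i} → i < L → Child c (legVertex l i) →
                       suc i < L × c ≡ legVertex l (suc i)
  legVertex-children (leaf childless) {zero}  _         cy = contradiction cy (childless _)
  legVertex-children (stem _ only l)  {zero}  _         cy = s≤s (Leg-nonempty l) , only _ cy
  legVertex-children (leaf _)         {suc i} (s≤s ())
  legVertex-children (stem _ _ l)     {suc i} (s≤s i<L) cv with legVertex-children l i<L cv
  ... | 1+i<L , eq = s≤s 1+i<L , eq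

  legFoot : ∀ {y L} → Leg y L → V
  legFoot {L = L} l = legVertex l (L ∸ 1)

  foot<length : ∀ {y L} → Leg y L → L ∸ 1 < L
  foot<length l = ∸-monoʳ-< (s≤s z≤n) (Leg-nonempty l)

  legFoot-Desc : ∀ {y L} (l : Leg y L) → Desc y (legFoot l)
  legFoot-Desc l = legVertex-Desc l (foot<length l)

  depth-legFoot : ∀ {y L} (l : Leg y L) → depth (legFoot l) ≡ depth y + (L ∸ 1)
  depth-legFoot l = depth-legVertex l (foot<length l)

  depth-in-Leg : ∀ {y L u} (l : Leg y L) → Desc y u → depth u < depth y + L
  depth-in-Leg {y} l d with legVertex-onto l d
  ... | i , i<L , refl = subst (_< depth y + _) (sym (depth-legVertex l i<L)) (+-monoʳ-< (depth y) i<L)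

  -- Read from the foot upwards, a leg below a child of p is a pendant path at p.
  Leg⇒PendantPath : ∀ {y p L} → Child y p → (l : Leg y L) → PendantPath T p L (λ i → legVertex l (L ∸ i))
  Leg⇒PendantPath {y} {p} {L} yp l = injective , ≢p , adjacency
    where
      x : ℕ → V
      x i = legVertex l (L ∸ i)

      below : ∀ {i} → 1 ≤ i → i ≤ L → L ∸ i < L
      below = ∸-monoʳ-<

      step : ∀ {i} → i < L → L ∸ i ≡ suc (L ∸ suc i)
      step = +-∸-assoc 1

      up : ∀ {i} → 1 ≤ i → i ≤ L → L ∸ pred i ≡ suc (L ∸ i)
      up {suc _} _ i≤L = step i≤L

      not-foot : ∀ {i} → 1 ≤ i → i ≤ L → suc (L ∸ i) < L → 2 ≤ i
      not-foot {suc zero}    _ 1≤L foot<L = contradiction foot<L (<-irrefl (m+[n∸m]≡n 1≤L))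
      not-foot {suc (suc _)} _ _   _      = s≤s (s≤s z≤n)

      depth-x : ∀ {i} → 1 ≤ i → i ≤ L → depth (x i) ≡ depth y + (L ∸ i)
      depth-x 1≤i i≤L = depth-legVertex l (below 1≤i i≤L)

      injective : ∀ i j → 1 ≤ i → i ≤ L → 1 ≤ j → j ≤ L → x i ≡ x j → i ≡ j
      injective i j 1≤i i≤L 1≤j j≤L eq = ∸-cancelˡ-≡ i≤L j≤L (+-cancelˡ-≡ (depth y) _ _
        (trans (sym (depth-x 1≤i i≤L)) (trans (cong depth eq) (depth-x 1≤j j≤L))))

      ≢p : ∀ i → 1 ≤ i → i ≤ L → x i ≢ p
      ≢p i 1≤i i≤L eq =
        <⇒≱ (≤-trans (≤-reflexive (sym (proj₂ yp))) (Desc-depth (legVertex-Desc l (below 1≤i i≤L))))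
            (≤-reflexive (cong depth eq))

      Adjacent : ℕ → V → Set
      Adjacent i u = (2 ≤ i × u ≡ x (pred i)) ⊎ (i < L × u ≡ x (suc i)) ⊎ (i ≡ L × u ≡ p)

      x-Child : ∀ {i} → 1 ≤ i → i < L → Child (x i) (x (suc i))
      x-Child {i} 1≤i i<L = subst (λ k → Child (legVertex l k) (x (suc i))) (sym (step i<L))
                              (legVertex-Child l (subst (_< L) (step i<L) (below 1≤i (<⇒≤ i<L))))

      to : ∀ {i u} → 1 ≤ i → i ≤ L → E T (x i) u → Adjacent i u
      to {i} {u} 1≤i i≤L e with edge⇒Child e
      ... | inj₂ ux with legVertex-children l (below 1≤i i≤L) ux
      ...   | 1+k<L , refl = inj₁ (not-foot 1≤i i≤L 1+k<L , cong (legVertex l) (sym (up 1≤i i≤L)))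
      to {i} {u} 1≤i i≤L e | inj₁ xu with m≤n⇒m<n∨m≡n i≤L
      ...   | inj₁ i<L  = inj₂ (inj₁ (i<L , parent-unique xu (x-Child 1≤i i<L)))
      ...   | inj₂ refl = inj₂ (inj₂ (refl , parent-unique (subst (λ k → Child (legVertex l k) u) (n∸n≡0 L) xu) yp))

      from : ∀ {i u} → 1 ≤ i → i ≤ L → Adjacent i u → E T (x i) u
      from {suc i} _   1+i≤L (inj₁ (s≤s 1≤i , refl))   = E-sym (proj₁ (x-Child 1≤i 1+i≤L))
      from         1≤i _     (inj₂ (inj₁ (i<L , refl))) = proj₁ (x-Child 1≤i i<L)
      from         _   _     (inj₂ (inj₂ (refl , refl))) =
        subst (λ k → E T (legVertex l k) p) (sym (n∸n≡0 L)) (proj₁ yp)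

      adjacency : ∀ i → 1 ≤ i → i ≤ L → ∀ u → E T (x i) u ⇔ Adjacent i u
      adjacency i 1≤i i≤L u = mk⇔ (to 1≤i i≤L) (from 1≤i i≤L)

  module SubdividedStar {d w} (legOf : ∀ c → Child c w → Leg c d) where

    t : ℕ
    t = length (children w)

    top : Fin t → V
    top j = lookup (children w) j

    top-Child : ∀ j → Child (top j) w
    top-Child j = ∈-children⁻ (∈-lookup j)

    legAt : ∀ j → Leg (top j) d
    legAt j = legOf (top j) (top-Child j)

    f : SV t d → V
    f nothing        = w
    f (just (j , i)) = legVertex (legAt j) (toℕ i)

    f-Desc-top : ∀ j i → Desc (top j) (f (just (j , i)))
    f-Desc-top j i = legVertex-Desc (legAt j) (toℕ<n i)

    f-Desc : ∀ a → Desc w (f a)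
    f-Desc nothing        = self
    f-Desc (just (j , i)) = Desc-trans (Desc-child (top-Child j)) (f-Desc-top j i)

    depth-f : ∀ j i → depth (f (just (j , i))) ≡ suc (depth w) + toℕ i
    depth-f j i = trans (depth-legVertex (legAt j) (toℕ<n i)) (cong (_+ toℕ i) (proj₂ (top-Child j)))

    w≢f : ∀ j i → w ≢ f (just (j , i))
    w≢f j i eq = <⇒≢ (s≤s (m≤m+n (depth w) (toℕ i))) (trans (cong depth eq) (depth-f j i))

    f-injective : ∀ a b → f a ≡ f b → a ≡ b
    f-injective nothing        nothing        _  = refl
    f-injective nothing        (just (j , i)) eq = contradiction eq (w≢f j i)
    f-injective (just (j , i)) nothing        eq = contradiction (sym eq) (w≢f j i)
    f-injective (just (j , i)) (just (j′ , i′)) eq = cong₂ (λ j i → just (j , i)) j≡j′ i≡i′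
      where
        i≡i′ : i ≡ i′
        i≡i′ = toℕ-injective (+-cancelˡ-≡ (suc (depth w)) _ _
                 (trans (sym (depth-f j i)) (trans (cong depth eq) (depth-f j′ i′))))
        j≡j′ : j ≡ j′
        j≡j′ = Unique-lookup-injective (Unique-children w)
          (Desc-ancestor-unique (f-Desc-top j i) (subst (Desc (top j′)) (sym eq) (f-Desc-top j′ i′))
            (trans (proj₂ (top-Child j)) (sym (proj₂ (top-Child j′)))))

    f-onto : ∀ u → InSub T r w u → ∃ λ a → f a ≡ u
    f-onto u in-w with Desc-split (InSub⇒Desc in-w)
    ... | inj₁ refl = nothing , refl
    ... | inj₂ (c , cw , dc) with ∈-children⁺ cw
    ...   | c∈ with legVertex-onto (legAt (Any.index c∈)) (subst (λ c → Desc c u) (AnyP.lookup-index c∈) dc)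
    ...     | i , i<d , eq = just (Any.index c∈ , fromℕ< i<d) , trans (cong (legVertex _) (toℕ-fromℕ< i<d)) eq

    SEdge⇒E : ∀ {a b} → SEdge t d a b → E T (f a) (f b)
    SEdge⇒E (hub j i i≡0) = subst (λ k → E T w (legVertex (legAt j) k)) (sym i≡0) (E-sym (proj₁ (top-Child j)))
    SEdge⇒E (leg j i i′ i′≡1+i) =
      subst (λ k → E T (legVertex (legAt j) (toℕ i)) (legVertex (legAt j) k)) (sym i′≡1+i)
        (E-sym (proj₁ (legVertex-Child (legAt j) (subst (_< d) i′≡1+i (toℕ<n i′)))))

    Child⇒SEdge : ∀ a b → Child (f a) (f b) → SEdge t d b a
    Child⇒SEdge nothing          b fb = contradiction (proj₂ fb) (<⇒≢ (s≤s (Desc-depth (f-Desc b))))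
    Child⇒SEdge (just (j , fzero)) b fb with f-injective b nothing (parent-unique fb (top-Child j))
    ... | refl = hub j fzero refl
    Child⇒SEdge (just (j , fsuc i)) b fb
      with f-injective b (just (j , inject₁ i))
             (parent-unique fb (subst (λ k → Child (f (just (j , fsuc i))) (legVertex (legAt j) k)) (sym (toℕ-inject₁ i))
               (legVertex-Child (legAt j) (toℕ<n (fsuc i)))))
    ... | refl = leg j (inject₁ i) (fsuc i) (cong suc (sym (toℕ-inject₁ i)))

    f-adjacency : ∀ a b → SAdj t d a b ⇔ E T (f a) (f b)
    f-adjacency a b = mk⇔ to from
      where
        to : SAdj t d a b → E T (f a) (f b)
        to (inj₁ ab) = SEdge⇒E ab
        to (inj₂ ba) = E-sym (SEdge⇒E ba)
        from : E T (f a) (f b) → SAdj t d a b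
        from e with edge⇒Child e
        ... | inj₁ ab = inj₂ (Child⇒SEdge a b ab)
        ... | inj₂ ba = inj₁ (Child⇒SEdge b a ba)

    iso : InducedIso T (InSub T r w) (SubdivStar t d)
    iso = f , f-injective , Desc⇒InSub ∘ f-Desc , f-onto , f-adjacency

  Branching⇒sibling : ∀ {w} → Branching w → ∀ c → ∃ λ c′ → c ≢ c′ × Child c′ w
  Branching⇒sibling (c₁ , c₂ , c₁≢c₂ , c₁w , c₂w) c with c ≟ᶠ c₁
  ... | yes refl = c₂ , c₁≢c₂ , c₂w
  ... | no c≢c₁  = c₁ , c≢c₁ , c₁w

  Branching⇒2≤children : ∀ {w} → Branching w → 2 ≤ length (children w)
  Branching⇒2≤children (_ , _ , c₁≢c₂ , c₁w , c₂w) =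
    2≤length (∈-children⁺ c₁w) (∈-children⁺ c₂w) c₁≢c₂

-- Subtrees hanging off a diametral path

module DiametralPath (d n : ℕ) (T : FinGraph n) (s : ℕ) (v : ℕ → Fin n)
  (2≤d : 2 ≤ d) (tree : IsTree T) (diam : Diam T s) (2d+1≤s : 2 * d + 1 ≤ s) (diam-path : DiamPath T s v)
  (no-P : ∀ w → ¬ PSupport T w (suc d))
  (no-PP : ∀ w i j → 1 ≤ i → i ≤ d ∸ 1 → 1 ≤ j → j ≤ d → ¬ PPSupport T w i j) where

  open Rooted T tree (v (s + 1)) public

  1≤d : 1 ≤ d
  1≤d = ≤-trans (s≤s z≤n) 2≤d

  1+d≤s : suc d ≤ s
  1+d≤s = ≤-trans (≤-trans (≤-reflexive (+-comm 1 d)) (+-monoˡ-≤ 1 (m≤m+n d (d + 0)))) 2d+1≤s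

  d≤s : d ≤ s
  d≤s = ≤-trans (n≤1+n d) 1+d≤s

  depth≤s : ∀ u → depth u ≤ s
  depth≤s u = proj₂ diam u (v (s + 1)) (depth u) (depth-Dist u)

  E-along : ∀ i → 1 ≤ i → i ≤ s → E T (v i) (v (suc i))
  E-along = proj₁ (proj₂ diam-path)

  along : ℕ → ℕ → V
  along k i = v (i + k)

  segment : ℕ → ℕ → List V
  segment k m = applyUpTo (along k) (suc m)

  segment-path : ∀ {k m} → 1 ≤ k → m + k ≡ suc s → IsPath T (v k) (v (s + 1)) (segment k m)
  segment-path {k} {m} 1≤k m+k≡1+s = linked , unique , refl , ends
    where
      bound : ∀ {i} → i ≤ m → i + k ≤ suc s
      bound i≤m = ≤-trans (+-monoˡ-≤ k i≤m) (≤-reflexive m+k≡1+s)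
      linked : Linked (E T) (segment k m)
      linked = Linked.applyUpTo⁺₁ (along k) (suc m) λ { {i} (s≤s i<m) →
        E-along (i + k) (≤-trans 1≤k (m≤n+m k i)) (≤-pred (bound i<m)) }
      unique : Unique (segment k m)
      unique = Unique.applyUpTo⁺₁ (along k) (suc m) λ { {i} {j} i<j (s≤s j≤m) eq →
        <⇒≢ i<j (+-cancelʳ-≡ k i j (proj₂ (proj₂ diam-path) (i + k) (j + k)
          (≤-trans 1≤k (m≤n+m k i)) (bound (≤-trans (<⇒≤ i<j) j≤m))
          (≤-trans 1≤k (m≤n+m k j)) (bound j≤m) eq)) }
      ends : last (segment k m) ≡ just (v (s + 1))
      ends = trans (cong last (sym (applyUpTo-∷ʳ (along k) m)))
               (trans (last-∷ʳ (applyUpTo (along k) m) _) (cong just (cong v (trans m+k≡1+s (+-comm 1 s)))))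

  depth-v : ∀ {k m} → 1 ≤ k → m + k ≡ suc s → depth (v k) ≡ m
  depth-v {k} {m} 1≤k m+k≡1+s =
    suc-injective (trans (sym (path-to-root-length (segment-path 1≤k m+k≡1+s))) (length-applyUpTo (along k) (suc m)))

  depth-v+k : ∀ {k} → 1 ≤ k → k ≤ suc s → depth (v k) + k ≡ suc s
  depth-v+k {k} 1≤k k≤1+s = trans (cong (_+ k) (depth-v 1≤k (m∸n+n≡m k≤1+s))) (m∸n+n≡m k≤1+s)

  Child-v : ∀ k → 1 ≤ k → k ≤ s → Child (v k) (v (suc k))
  Child-v k 1≤k k≤s = E-along k 1≤k k≤s , +-cancelʳ-≡ k _ _
    (trans (depth-v+k 1≤k (m≤n⇒m≤1+n k≤s)) (sym (trans (sym (+-suc _ k)) (depth-v+k (s≤s z≤n) (s≤s k≤s)))))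

  Desc-v : ∀ {i j} → 1 ≤ i → i ≤ j → j ≤ suc s → Desc (v j) (v i)
  Desc-v {i} {j} 1≤i i≤j j≤1+s = InSub⇒Desc
    (segment i (suc s ∸ i) , segment-path 1≤i (m∸n+n≡m (≤-trans i≤j j≤1+s)) ,
     subst (λ k → v k ∈ segment i (suc s ∸ i)) (m∸n+n≡m i≤j)
       (∈-applyUpTo⁺ (along i) (s≤s (∸-monoˡ-≤ i j≤1+s))))

  ShortLeg : V → Set
  ShortLeg y = ∃ λ L → L ≤ d × Leg y L

  Deep : V → Set
  Deep y = (∃ λ z → Desc y z × Branching z) × (∃ λ ℓ → Desc y ℓ × depth y + d ≤ depth ℓ)

  Deep-lift : ∀ {c y} → Child c y → Deep c → Deep y
  Deep-lift cy ((z , cz , br) , ℓ , cℓ , c+d≤ℓ) =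
    (z , Desc-trans (Desc-child cy) cz , br) , ℓ , Desc-trans (Desc-child cy) cℓ ,
    ≤-trans (+-monoˡ-≤ d (≤-trans (n≤1+n _) (≤-reflexive (sym (proj₂ cy))))) c+d≤ℓ

  no-short-leg-pair : ∀ {w c₁ c₂ L₁ L₂} → c₁ ≢ c₂ → Child c₁ w → Child c₂ w → Leg c₁ L₁ → Leg c₂ L₂ →
                      L₁ ≤ d ∸ 1 → L₂ ≤ d → ⊥
  no-short-leg-pair {w} c₁≢c₂ c₁w c₂w l₁ l₂ L₁≤ L₂≤ =
    no-PP w _ _ (Leg-nonempty l₁) L₁≤ (Leg-nonempty l₂) L₂≤
      (_ , _ , Leg⇒PendantPath c₁w l₁ , Leg⇒PendantPath c₂w l₂ , feet-distinct)
    where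
      feet-distinct : legFoot l₁ ≢ legFoot l₂
      feet-distinct eq = c₁≢c₂ (Desc-ancestor-unique (legFoot-Desc l₁) (subst (Desc _) (sym eq) (legFoot-Desc l₂))
                                  (trans (proj₂ c₁w) (sym (proj₂ c₂w))))

  sibling-leg-length : ∀ {w c₁ c₂ L₁ L₂} → c₁ ≢ c₂ → Child c₁ w → Child c₂ w → Leg c₁ L₁ → Leg c₂ L₂ →
                       L₁ ≤ d → L₂ ≤ d → L₁ ≡ d
  sibling-leg-length {L₁ = L₁} c₁≢c₂ c₁w c₂w l₁ l₂ L₁≤d L₂≤d with L₁ ≤? d ∸ 1
  ... | yes L₁≤ = ⊥-elim (no-short-leg-pair c₁≢c₂ c₁w c₂w l₁ l₂ L₁≤ L₂≤d)
  ... | no  L₁≰ = ≤-antisym L₁≤d (subst (_≤ L₁) (m+[n∸m]≡n 1≤d) (≰⇒> L₁≰))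

  full-leg⇒Deep : ∀ {y c} → Branching y → Child c y → Leg c d → Deep y
  full-leg⇒Deep {y} {c} br cy l = (y , self , br) , legFoot l , Desc-trans (Desc-child cy) (legFoot-Desc l) , y+d≤foot
    where
      y+d≤foot : depth y + d ≤ depth (legFoot l)
      y+d≤foot = ≤-reflexive (sym (begin
        depth (legFoot l)         ≡⟨ depth-legFoot l ⟩
        depth c + (d ∸ 1)         ≡⟨ cong (_+ (d ∸ 1)) (proj₂ cy) ⟩
        suc (depth y) + (d ∸ 1)   ≡⟨ sym (+-suc (depth y) (d ∸ 1)) ⟩
        depth y + suc (d ∸ 1)     ≡⟨ cong (depth y +_) (m+[n∸m]≡n 1≤d) ⟩
        depth y + d               ∎))
        where open ≡-Reasoning

  ¬Child-at-depth-s : ∀ {c y} → Child c y → s ≤ depth y + 0 → ⊥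
  ¬Child-at-depth-s {c} {y} (_ , c≡1+y) s≤y = <-irrefl refl
    (≤-trans (≤-reflexive (sym c≡1+y)) (≤-trans (depth≤s c) (≤-trans s≤y (≤-reflexive (+-identityʳ (depth y))))))

  Child-fuel : ∀ {c y} F → Child c y → s ≤ depth y + suc F → s ≤ depth c + F
  Child-fuel {y = y} F (_ , c≡1+y) s≤ = ≤-trans s≤ (≤-reflexive (trans (+-suc (depth y) F) (cong (_+ F) (sym c≡1+y))))

  -- Induction on the fuel F ≥ s ∸ depth y, which bounds the height of T_y.
  Leg-or-Deep-within : ∀ F {y p} → s ≤ depth y + F → Child y p → ShortLeg y ⊎ Deep y
  Leg-or-Deep-within F {y} s≤ yp with childrenView y
  ... | none childless = inj₁ (1 , 1≤d , leaf childless)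
  Leg-or-Deep-within zero    s≤ yp | one cy _                     = ⊥-elim (¬Child-at-depth-s cy s≤)
  Leg-or-Deep-within zero    s≤ yp | many (_ , _ , _ , c₁y , _) = ⊥-elim (¬Child-at-depth-s c₁y s≤)
  Leg-or-Deep-within (suc F) s≤ yp | one cy only with Leg-or-Deep-within F (Child-fuel F cy s≤) cy
  ... | inj₂ deep = inj₂ (Deep-lift cy deep)
  ... | inj₁ (L , L≤d , l) with suc L ≤? d
  ...   | yes 1+L≤d = inj₁ (suc L , 1+L≤d , stem cy only l)
  ...   | no  1+L≰d = ⊥-elim (no-P _ (subst (λ L → PSupport T _ (suc L)) (≤-antisym L≤d (≤-pred (≰⇒> 1+L≰d)))
                                  (_ , Leg⇒PendantPath yp (stem cy only l))))
  Leg-or-Deep-within (suc F) s≤ yp | many br@(_ , _ , c₁≢c₂ , c₁y , c₂y)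
    with Leg-or-Deep-within F (Child-fuel F c₁y s≤) c₁y | Leg-or-Deep-within F (Child-fuel F c₂y s≤) c₂y
  ... | inj₂ deep             | _                     = inj₂ (Deep-lift c₁y deep)
  ... | inj₁ _                | inj₂ deep             = inj₂ (Deep-lift c₂y deep)
  ... | inj₁ (L₁ , L₁≤d , l₁) | inj₁ (L₂ , L₂≤d , l₂)
    with sibling-leg-length c₁≢c₂ c₁y c₂y l₁ l₂ L₁≤d L₂≤d
  ...   | refl = inj₂ (full-leg⇒Deep br c₁y l₁)

  Leg-or-Deep : ∀ {y p} → Child y p → ShortLeg y ⊎ Deep y
  Leg-or-Deep {y} = Leg-or-Deep-within s (m≤n+m s (depth y))

  legs-of-Branching : ∀ {w} → Branching w → (∀ {c} → Child c w → ShortLeg c) → ∀ c → Child c w → Leg c d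
  legs-of-Branching br short c cw with short cw | Branching⇒sibling br c
  ... | L , L≤d , l | c′ , c≢c′ , c′w with short c′w
  ...   | L′ , L′≤d , l′ = subst (Leg c) (sibling-leg-length c≢c′ cw c′w l l′ L≤d L′≤d) l

  Star : V → Set
  Star w = StarAt T (InSub T (v (s + 1)) w) w d

  short-legs⇒Star : ∀ {w} → Branching w → (∀ {c} → Child c w → ShortLeg c) → Star w
  short-legs⇒Star br short = _ , Branching⇒2≤children br , SubdividedStar.iso (legs-of-Branching br short) , refl

  isolated-branch-Star : ∀ w → 3 ≤ deg T w → (∀ u → InSub T (v (s + 1)) w u → u ≢ w → deg T u < 3) → Star w
  isolated-branch-Star w 3≤w others = short-legs⇒Star (3≤deg⇒Branching 3≤w) short
    where
      short : ∀ {c} → Child c w → ShortLeg c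
      short cw with Leg-or-Deep cw
      ... | inj₁ short-leg = short-leg
      ... | inj₂ ((z , cz , br) , _) =
        ⊥-elim (<⇒≱ (others z (Desc⇒InSub wz) z≢w) (Branching⇒3≤deg br (proj₂ (Desc-has-parent cw cz))))
        where
          wz : Desc w z
          wz = Desc-trans (Desc-child cw) cz
          z≢w : z ≢ w
          z≢w refl = <⇒≱ (≤-reflexive (sym (proj₂ cw))) (Desc-depth cz)

  depth-Child-v : ∀ {k c} → k ≤ s → Child c (v (suc k)) → depth c + k ≡ suc s
  depth-Child-v {k} k≤s (_ , c≡) = trans (cong (_+ k) c≡) (trans (sym (+-suc _ k)) (depth-v+k (s≤s z≤n) (s≤s k≤s)))

  -- c lies at depth s + 1 − k, and no vertex is deeper than s.
  ShortLeg-off-path : ∀ {k c} → k ≤ d → Child c (v (suc k)) → ∃ λ L → L ≤ k × Leg c L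
  ShortLeg-off-path {k} {c} k≤d cv with Leg-or-Deep cv | depth-Child-v (≤-trans k≤d d≤s) cv
  ... | inj₂ (_ , ℓ , _ , c+d≤ℓ) | c+k≡1+s = ⊥-elim (<-irrefl refl (begin-strict
    s             <⟨ n<1+n s ⟩
    suc s         ≡⟨ sym c+k≡1+s ⟩
    depth c + k   ≤⟨ +-monoʳ-≤ (depth c) k≤d ⟩
    depth c + d   ≤⟨ c+d≤ℓ ⟩
    depth ℓ       ≤⟨ depth≤s ℓ ⟩
    s             ∎))
    where open ≤-Reasoning
  ... | inj₁ (L , _ , l) | c+k≡1+s = L , +-cancelˡ-≤ (depth c) L k (begin
    depth c + L               ≡⟨ cong (depth c +_) (sym (m+[n∸m]≡n (Leg-nonempty l))) ⟩
    depth c + suc (L ∸ 1)     ≡⟨ +-suc (depth c) (L ∸ 1) ⟩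
    suc (depth c + (L ∸ 1))   ≡⟨ cong suc (sym (depth-legFoot l)) ⟩
    suc (depth (legFoot l))   ≤⟨ s≤s (depth≤s (legFoot l)) ⟩
    suc s                     ≡⟨ sym c+k≡1+s ⟩
    depth c + k               ∎) , l
    where open ≤-Reasoning

  deg-v≡2 : ∀ k → 2 ≤ k → k ≤ d → deg T (v k) ≡ 2
  deg-v≡2 (suc j) (s≤s 1≤j) 1+j≤d = deg≡2 (E-sym (proj₁ below)) (proj₁ above) (Child⇒≢parent below above) only
    where
      j≤d : j ≤ d
      j≤d = ≤-trans (n≤1+n j) 1+j≤d
      below : Child (v j) (v (suc j))
      below = Child-v j 1≤j (≤-trans j≤d d≤s)
      above : Child (v (suc j)) (v (suc (suc j)))
      above = Child-v (suc j) (s≤s z≤n) (≤-trans 1+j≤d d≤s)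
      only : ∀ u → E T (v (suc j)) u → u ≡ v j ⊎ u ≡ v (suc (suc j))
      only u e with edge⇒Child e
      ... | inj₁ parent = inj₂ (parent-unique parent above)
      ... | inj₂ child with u ≟ᶠ v j
      ...   | yes u≡vj = inj₁ u≡vj
      ...   | no  u≢vj with ShortLeg-off-path j≤d child | ShortLeg-off-path j≤d below
      ...     | L , L≤j , l | L′ , L′≤j , l′ = ⊥-elim (
        no-short-leg-pair u≢vj child below l l′ (≤-trans L≤j (∸-monoˡ-≤ 1 1+j≤d)) (≤-trans L′≤j j≤d))

  x : V
  x = v (suc d)

  y : V
  y = v (suc (suc d))

  x-Child-y : Child x y
  x-Child-y = Child-v (suc d) (s≤s z≤n) 1+d≤s

  v1-below-x : Desc x (v 1)
  v1-below-x = Desc-v (s≤s z≤n) (s≤s z≤n) (s≤s d≤s)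

  vd-Child-x : Child (v d) x
  vd-Child-x = Child-v d 1≤d d≤s

  -- v₁ lies d − 1 levels below v_d.
  Leg-vd-long : ∀ {L} → Leg (v d) L → d ≤ L
  Leg-vd-long {L} l = +-cancelˡ-≤ (depth (v d)) d L (begin
    depth (v d) + d   ≡⟨ trans (depth-v+k 1≤d (≤-trans d≤s (n≤1+n s))) (sym (depth-v+k (s≤s z≤n) (s≤s z≤n))) ⟩
    depth (v 1) + 1   ≡⟨ +-comm (depth (v 1)) 1 ⟩
    suc (depth (v 1)) ≤⟨ depth-in-Leg l (Desc-v (s≤s z≤n) 1≤d (≤-trans d≤s (n≤1+n s))) ⟩
    depth (v d) + L   ∎)
    where open ≤-Reasoning

  -- Otherwise the leg below v_d, extended by x, would be a pendant P_{d+1} at y.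
  x-Branching : Branching x
  x-Branching with childrenView x
  ... | none childless = contradiction vd-Child-x (childless (v d))
  ... | many br        = br
  ... | one {c} cx only with ShortLeg-off-path ≤-refl vd-Child-x
  ...   | L , L≤d , l with only (v d) vd-Child-x
  ...     | refl = ⊥-elim (no-P y (subst (λ L → PSupport T y (suc L)) (≤-antisym L≤d (Leg-vd-long l))
                                     (_ , Leg⇒PendantPath x-Child-y (stem cx only l))))

  3≤deg-x : 3 ≤ deg T x
  3≤deg-x = Branching⇒3≤deg x-Branching x-Child-y

  Star-x : Star x
  Star-x = short-legs⇒Star x-Branching (ShortLeg-off-path ≤-refl)

  open EdgeCut x-Child-y v1-below-x public

  double-Star : ∀ {S c} → (∀ {u} → S u → InSub T (v 1) y u) → (∀ {u} → InSub T (v 1) y u → S u) →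
                c ≡ y → StarAt T S c d → DoubleStar T d
  double-Star {S} into onto refl (t₂ , 2≤t₂ , iso₂ , centre₂) = glue Star-x
    where
      glue : Star x → DoubleStar T d
      glue (t₁ , 2≤t₁ , iso₁ , centre₁) = t₁ , t₂ , 2≤t₁ , 2≤t₂ ,
        glue-SubdivStars iso₁ iso₂ (Sum.map₂ onto ∘ cover) (λ in₁ in₂ → disjoint in₁ (into in₂)) centres bridge
        where
          centres : ∀ {a b} → InSub T (v (s + 1)) x a → S b → E T a b →
                    a ≡ proj₁ iso₁ nothing × b ≡ proj₁ iso₂ nothing
          centres in₁ in₂ e with crossing in₁ (into in₂) e
          ... | a≡x , b≡y = trans a≡x (sym centre₁) , trans b≡y (sym centre₂)
          bridge : E T (proj₁ iso₁ nothing) (proj₁ iso₂ nothing)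
          bridge = subst₂ (E T) (sym centre₁) (sym centre₂) (proj₁ x-Child-y)

-- Both ends of the path

mirror : ℕ → ℕ → ℕ
mirror s i = suc (suc s) ∸ i

mirror-involutive : ∀ {s i} → i ≤ suc (suc s) → mirror s (mirror s i) ≡ i
mirror-involutive = m∸[m∸n]≡n

reverse-DiamPath : ∀ {n} (T : FinGraph n) {s v} → DiamPath T s v → DiamPath T s (v ∘ mirror s)
reverse-DiamPath T {s} {v} (diam , along , injective) = diam , along′ , injective′
  where
    along′ : ∀ i → 1 ≤ i → i ≤ s → E T (v (mirror s i)) (v (mirror s (suc i)))
    along′ i 1≤i i≤s = subst (λ k → E T (v k) (v (suc s ∸ i))) (sym (+-∸-assoc 1 (m≤n⇒m≤1+n i≤s)))
      (FinGraphProperties.E-sym T (along (suc s ∸ i) (m<n⇒0<n∸m (s≤s i≤s)) (∸-monoʳ-≤ (suc s) 1≤i)))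
    injective′ : ∀ i j → 1 ≤ i → i ≤ suc s → 1 ≤ j → j ≤ suc s → v (mirror s i) ≡ v (mirror s j) → i ≡ j
    injective′ i j 1≤i i≤1+s 1≤j j≤1+s eq = ∸-cancelˡ-≡ (m≤n⇒m≤1+n i≤1+s) (m≤n⇒m≤1+n j≤1+s)
      (injective _ _ (m<n⇒0<n∸m (s≤s i≤1+s)) (∸-monoʳ-≤ (suc (suc s)) 1≤i)
                     (m<n⇒0<n∸m (s≤s j≤1+s)) (∸-monoʳ-≤ (suc (suc s)) 1≤j) eq)

mirror-end : ∀ s → mirror s (s + 1) ≡ 1
mirror-end s = trans (cong (mirror s) (+-comm s 1)) (m+n∸n≡m 1 s)

2≤mirror : ∀ {s k} → k ≤ s → 2 ≤ mirror s k
2≤mirror {s} k≤s = ≤-trans (≤-reflexive (sym (m+n∸n≡m 2 s))) (∸-monoʳ-≤ (suc (suc s)) k≤s)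

mirror≤ : ∀ {s d k} → d ≤ s → s ∸ d + 2 ≤ k → mirror s k ≤ d
mirror≤ {s} {d} d≤s le = ≤-trans (∸-monoʳ-≤ (suc (suc s)) (≤-trans (≤-reflexive (+-comm 2 (s ∸ d))) le))
                                 (≤-reflexive (m∸[m∸n]≡n d≤s))

mirror-1+ : ∀ {s d} → d ≤ s → mirror s (suc d) ≡ s ∸ d + 1
mirror-1+ {s} {d} d≤s = trans (+-∸-assoc 1 d≤s) (+-comm 1 (s ∸ d))

mirror-1+-centre : ∀ {s d} → d ≤ s → s ≡ 2 * d + 1 → mirror s (suc d) ≡ suc (suc d)
mirror-1+-centre {s} {d} d≤s s≡2d+1 = trans (+-∸-assoc 1 d≤s) (cong suc (begin
  s ∸ d           ≡⟨ cong (_∸ d) s≡2d+1 ⟩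
  2 * d + 1 ∸ d   ≡⟨ cong (_∸ d) (+-assoc d (d + 0) 1) ⟩
  d + (d + 0 + 1) ∸ d ≡⟨ m+n∸m≡n d _ ⟩
  d + 0 + 1       ≡⟨ cong (_+ 1) (+-identityʳ d) ⟩
  d + 1           ≡⟨ +-comm d 1 ⟩
  suc d           ∎))
  where open ≡-Reasoning

module BothEnds (d n : ℕ) (T : FinGraph n) (s : ℕ) (v : ℕ → Fin n)
  (2≤d : 2 ≤ d) (tree : IsTree T) (diam : Diam T s) (2d+1≤s : 2 * d + 1 ≤ s) (diam-path : DiamPath T s v)
  (no-P : ∀ w → ¬ PSupport T w (suc d))
  (no-PP : ∀ w i j → 1 ≤ i → i ≤ d ∸ 1 → 1 ≤ j → j ≤ d → ¬ PPSupport T w i j) where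

  module P  = DiametralPath d n T s v 2≤d tree diam 2d+1≤s diam-path no-P no-PP
  module P′ = DiametralPath d n T s (v ∘ mirror s) 2≤d tree diam 2d+1≤s (reverse-DiamPath T diam-path) no-P no-PP

  deg≡2-near-ends : ∀ k → (2 ≤ k × k ≤ d) ⊎ (s ∸ d + 2 ≤ k × k ≤ s) → deg T (v k) ≡ 2
  deg≡2-near-ends k (inj₁ (2≤k , k≤d)) = P.deg-v≡2 k 2≤k k≤d
  deg≡2-near-ends k (inj₂ (le , k≤s))  =
    subst (λ k → deg T (v k) ≡ 2) (mirror-involutive (≤-trans k≤s (≤-trans (n≤1+n s) (n≤1+n _))))
      (P′.deg-v≡2 (mirror s k) (2≤mirror k≤s) (mirror≤ P.d≤s le))

  3≤deg-at-distance-d : 3 ≤ deg T (v (d + 1)) × 3 ≤ deg T (v (s ∸ d + 1))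
  3≤deg-at-distance-d = subst (λ k → 3 ≤ deg T (v k)) (+-comm 1 d) P.3≤deg-x ,
                        subst (λ k → 3 ≤ deg T (v k)) (mirror-1+ P.d≤s) P′.3≤deg-x

  isolated-branch-star : ∀ w → 3 ≤ deg T w → (∀ u → InSub T (v (s + 1)) w u → u ≢ w → deg T u < 3) →
                         ∃ λ t → 2 ≤ t × InducedIso T (InSub T (v (s + 1)) w) (SubdivStar t d)
  isolated-branch-star w 3≤w others = StarAt⇒InducedIso T (P.isolated-branch-Star w 3≤w others)

  star-at-v[d+1] : ∃ λ t → 2 ≤ t × InducedIso T (InSub T (v (s + 1)) (v (d + 1))) (SubdivStar t d)
  star-at-v[d+1] = subst (λ k → ∃ λ t → 2 ≤ t × InducedIso T (InSub T (v (s + 1)) (v k)) (SubdivStar t d))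
                     (+-comm 1 d) (StarAt⇒InducedIso T P.Star-x)

  -- The reversed path is rooted at v₁, and its vertex x is v_{d+2} = P.y.
  double-star : s ≡ 2 * d + 1 → DoubleStar T d
  double-star s≡2d+1 = P.double-Star into onto y′ P′.Star-x
    where
      root′ : v (mirror s (s + 1)) ≡ v 1
      root′ = cong v (mirror-end s)
      y′ : v (mirror s (suc d)) ≡ P.y
      y′ = cong v (mirror-1+-centre P.d≤s s≡2d+1)
      into : ∀ {u} → InSub T (v (mirror s (s + 1))) (v (mirror s (suc d))) u → InSub T (v 1) P.y u
      into {u} = subst₂ (λ a b → InSub T a b u) root′ y′
      onto : ∀ {u} → InSub T (v 1) P.y u → InSub T (v (mirror s (s + 1))) (v (mirror s (suc d))) u
      onto {u} = subst₂ (λ a b → InSub T a b u) (sym root′) (sym y′)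

lemma3p3 : (d n : ℕ) (T : FinGraph n) (s : ℕ) (v : ℕ → Fin n) →
    2 ≤ d → IsTree T → Diam T s → 2 * d + 1 ≤ s → DiamPath T s v →
    (∀ w → ¬ PSupport T w (suc d)) →
    (∀ w i j → 1 ≤ i → i ≤ d ∸ 1 → 1 ≤ j → j ≤ d → ¬ PPSupport T w i j) →
    -- (i)
    (∀ k → (2 ≤ k × k ≤ d) ⊎ (s ∸ d + 2 ≤ k × k ≤ s) → deg T (v k) ≡ 2)
    -- (ii)
    × (3 ≤ deg T (v (d + 1)) × 3 ≤ deg T (v (s ∸ d + 1)))
    -- (iii)  (T rooted at v_{s+1})
    × (∀ w → 3 ≤ deg T w →
         (∀ u → InSub T (v (s + 1)) w u → u ≢ w → deg T u < 3) →
         ∃ λ t → 2 ≤ t × InducedIso T (InSub T (v (s + 1)) w) (SubdivStar t d))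
    -- (iv)
    × (∃ λ t → 2 ≤ t × InducedIso T (InSub T (v (s + 1)) (v (d + 1))) (SubdivStar t d))
    -- (v)
    × (s ≡ 2 * d + 1 →
         Σ ℕ λ t₁ → Σ ℕ λ t₂ → 2 ≤ t₁ × 2 ≤ t₂ ×
           InducedIso T (λ _ → ⊤) (DoubleSubdivStar t₁ t₂ d))
lemma3p3 d n T s v 2≤d tree diam 2d+1≤s diam-path no-P no-PP =
  deg≡2-near-ends , 3≤deg-at-distance-d , isolated-branch-star , star-at-v[d+1] , double-star
  where open BothEnds d n T s v 2≤d tree diam 2d+1≤s diam-path no-P no-PP
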